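{- Let $P,Q$ be Dyck paths of size $n$ with $P \le Q$ in the Tamari order. For $A\in\{P,Q\}$ and $1\le j\le n$, let $u_j^A$ be the $j$-th up step of $A$, $d_j^A$ its matching down step, and $A^{[j]}$ the factor of $A$ strictly between $u_j^A$ and $d_j^A$. Then for all indices $i,j$, if the $i$-th up step $u_i^P$ of $P$ lies in $P^{[j]}$, then the $i$-th up step $u_i^Q$ of $Q$ lies in $Q^{[j]}$.
   Context: A Dyck path of size $n$ is a word with $n$ letters $u=(1,1)$ and $n$ letters $d=(1,-1)$ whose walk from $(0,0)$ never goes below the $x$-axis. The matching down step of an up step $u_i$ is the first down step after $u_i$ that ends at the height where $u_i$ starts (the first down step hit by a horizontal ray drawn to the right from the middle of $u_i$). Tamari order: if $P=A\,d\,U\,C$ where $U=uBd$ is a Dyck path which returns to its starting height only at its end, then $P$ is covered by $A\,U\,d\,C$; the Tamari order $\le$ is the reflexive–transitive closure of this covering relation. -}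

module Defs where

open import Data.Nat using (ℕ; zero; suc; _<_; _≤_)
open import Data.Integer using (ℤ; +_; _+_; -_; 0ℤ; 1ℤ) renaming (_≤_ to _≤ℤ_)
open import Data.List using (List; []; _∷_; _++_; take; drop; length; filter)
open import Data.Product using (Σ; ∃; ∃-syntax; _×_; _,_)
open import Relation.Binary.PropositionalEquality using (_≡_; _≢_)
open import Relation.Nullary using (¬_)
open import Relation.Binary.Construct.Closure.ReflexiveTransitive using (Star)

-- Steps: u = (1,1), d = (1,-1)
data Step : Set where
  u d : Step

Word : Set
Word = List Step

height : Word → ℤ
height []       = 0ℤ
height (u ∷ w)  = 1ℤ + height w
height (d ∷ w)  = - 1ℤ + height w

#u : Word → ℕ
#u []      = 0
#u (u ∷ w) = suc (#u w)
#u (d ∷ w) = #u w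

#d : Word → ℕ
#d []      = 0
#d (u ∷ w) = #d w
#d (d ∷ w) = suc (#d w)

NeverBelow : Word → Set
NeverBelow w = ∀ xs ys → w ≡ xs ++ ys → 0ℤ ≤ℤ height xs

IsDyck : Word → Set
IsDyck w = NeverBelow w × height w ≡ 0ℤ

DyckOfSize : ℕ → Word → Set
DyckOfSize n w = #u w ≡ n × #d w ≡ n × NeverBelow w

IsPrimeDyck : Word → Set
IsPrimeDyck U = IsDyck U × U ≢ [] ×
  (∀ xs ys → U ≡ xs ++ ys → xs ≢ [] → ys ≢ [] → height xs ≢ 0ℤ)

data Covers (P Q : Word) : Set where
  cover : (A U C : Word) → IsPrimeDyck U →
          P ≡ A ++ (d ∷ U ++ C) → Q ≡ A ++ (U ++ d ∷ C) → Covers P Q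

_≤T_ : Word → Word → Set
_≤T_ = Star Covers

-- letter s occurs at 0-based position p of w
LetterAt : Word → ℕ → Step → Set
LetterAt w p s = ∃[ rest ] drop p w ≡ s ∷ rest

-- the j-th up step (j ≥ 1) of w is at 0-based position p
UpPos : Word → ℕ → ℕ → Set
UpPos w j p = LetterAt w p u × suc (#u (take p w)) ≡ j

DownEndingAt : Word → ℕ → ℤ → Set
DownEndingAt w m h = LetterAt w m d × height (take (suc m) w) ≡ h

Matches : Word → ℕ → ℕ → Set
Matches w p m = LetterAt w p u × p < m ×
  DownEndingAt w m (height (take p w)) ×
  (∀ k → p < k → k < m → ¬ DownEndingAt w k (height (take p w)))

UpInFactor : Word → ℕ → ℕ → Set
UpInFactor w i j = ∃[ p ] ∃[ m ] ∃[ q ]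
  UpPos w j p × Matches w p m × UpPos w i q × p < q × q < m

module Submission where

-- In a cover
-- the blocks A and C keep positions and statistics, while the letters of U
-- move one place left and one unit up.  Since U never dips below its start,
-- an arch of P starting in A cannot end inside U, and one starting in U
-- cannot leave U; an arch ending at the moved d ends in Q at its new place.
-- In every case the arch and the up steps inside it have counterparts in Q
-- with the same indices.

open import Defs
open import Data.Nat using (ℕ; _≤_)
open import Data.Nat as ℕ using (zero; suc; z≤n; s≤s; _+_; _<_)
import Data.Nat.Properties as ℕP
open import Data.Integer as ℤ using (ℤ; 0ℤ; 1ℤ; -_) renaming (_+_ to _+ℤ_)
import Data.Integer.Properties as ℤP
open import Data.Integer.Tactic.RingSolver using (solve-∀)
open import Data.List using (List; []; _∷_; _++_; take; drop; length; head)
import Data.List.Properties as LP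
open import Data.Maybe using (Maybe; just)
open import Data.Product using (∃-syntax; _×_; _,_; proj₁; proj₂)
open import Data.Empty using (⊥-elim)
open import Function using (id; _∘_)
open import Relation.Nullary using (¬_; yes; no)
open import Relation.Binary using (tri<; tri≈; tri>)
open import Relation.Binary.PropositionalEquality
open import Relation.Binary.Construct.Closure.ReflexiveTransitive using (ε; _◅_)

module _ {X : Set} where

  take-++ˡ : ∀ (xs ys : List X) k → k ≤ length xs → take k (xs ++ ys) ≡ take k xs
  take-++ˡ xs       ys zero    _         = refl
  take-++ˡ (x ∷ xs) ys (suc k) (s≤s k≤n) = cong (x ∷_) (take-++ˡ xs ys k k≤n)

  take-++ʳ : ∀ (xs ys : List X) r → take (length xs + r) (xs ++ ys) ≡ xs ++ take r ys
  take-++ʳ []       ys r = refl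
  take-++ʳ (x ∷ xs) ys r = cong (x ∷_) (take-++ʳ xs ys r)

  drop-++ʳ : ∀ (xs ys : List X) r → drop (length xs + r) (xs ++ ys) ≡ drop r ys
  drop-++ʳ []       ys r = refl
  drop-++ʳ (x ∷ xs) ys r = drop-++ʳ xs ys r

  drop-++-length : ∀ (xs ys : List X) → drop (length xs) (xs ++ ys) ≡ ys
  drop-++-length []       ys = refl
  drop-++-length (x ∷ xs) ys = drop-++-length xs ys

  head-drop-++ˡ : ∀ (xs ys : List X) k → k < length xs →
                  head (drop k (xs ++ ys)) ≡ head (drop k xs)
  head-drop-++ˡ (x ∷ xs) ys zero    _         = refl
  head-drop-++ˡ (x ∷ xs) ys (suc k) (s≤s k<n) = head-drop-++ˡ xs ys k k<n

  take-suc : ∀ (xs : List X) k {x} → head (drop k xs) ≡ just x →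
             take (suc k) xs ≡ take k xs ++ x ∷ []
  take-suc []       zero    ()
  take-suc []       (suc k) ()
  take-suc (y ∷ xs) zero    refl = refl
  take-suc (y ∷ xs) (suc k) e    = cong (y ∷_) (take-suc xs k e)

  occupied-before : ∀ (xs : List X) {k m x} → k < m → head (drop m xs) ≡ just x →
                    ∃[ y ] head (drop k xs) ≡ just y
  occupied-before []       {m = zero}  _   ()
  occupied-before []       {m = suc m} _   ()
  occupied-before (y ∷ xs) {zero}      _   _ = y , refl
  occupied-before (y ∷ xs) {suc k} {suc m} (s≤s k<m) e = occupied-before xs k<m e

at : Word → ℕ → Maybe Step
at w k = head (drop k w)

heightAt : Word → ℕ → ℤ
heightAt w k = height (take k w)

upsBefore : Word → ℕ → ℕ
upsBefore w k = #u (take k w)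

letterAt⇒at : ∀ w k {s} → LetterAt w k s → at w k ≡ just s
letterAt⇒at w k (rest , e) = cong head e

at⇒letterAt : ∀ w k {s} → at w k ≡ just s → LetterAt w k s
at⇒letterAt w k e with drop k w
at⇒letterAt w k refl | s ∷ rest = rest , refl

val : Step → ℤ
val u = 1ℤ
val d = - 1ℤ

height-∷ : ∀ s w → height (s ∷ w) ≡ val s +ℤ height w
height-∷ u w = refl
height-∷ d w = refl

height-++ : ∀ X Y → height (X ++ Y) ≡ height X +ℤ height Y
height-++ []      Y = sym (ℤP.+-identityˡ (height Y))
height-++ (s ∷ X) Y = begin
  height (s ∷ X ++ Y)             ≡⟨ height-∷ s (X ++ Y) ⟩
  val s +ℤ height (X ++ Y)        ≡⟨ cong (val s +ℤ_) (height-++ X Y) ⟩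
  val s +ℤ (height X +ℤ height Y) ≡⟨ ℤP.+-assoc (val s) (height X) (height Y) ⟨
  val s +ℤ height X +ℤ height Y   ≡⟨ cong (_+ℤ height Y) (height-∷ s X) ⟨
  height (s ∷ X) +ℤ height Y      ∎
  where open ≡-Reasoning

#u-++ : ∀ X Y → #u (X ++ Y) ≡ #u X + #u Y
#u-++ []      Y = refl
#u-++ (u ∷ X) Y = cong suc (#u-++ X Y)
#u-++ (d ∷ X) Y = #u-++ X Y

height-tail-≡ : ∀ X {T T'} → height T ≡ height T' → height (X ++ T) ≡ height (X ++ T')
height-tail-≡ X {T} {T'} e = begin
  height (X ++ T)       ≡⟨ height-++ X T ⟩
  height X +ℤ height T  ≡⟨ cong (height X +ℤ_) e ⟩
  height X +ℤ height T' ≡⟨ height-++ X T' ⟨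
  height (X ++ T')      ∎
  where open ≡-Reasoning

height-tail-≤ : ∀ X {T T'} → height T ℤ.≤ height T' → height (X ++ T) ℤ.≤ height (X ++ T')
height-tail-≤ X {T} {T'} le =
  subst₂ ℤ._≤_ (sym (height-++ X T)) (sym (height-++ X T')) (ℤP.+-monoʳ-≤ (height X) le)

#u-tail-≡ : ∀ X {T T'} → #u T ≡ #u T' → #u (X ++ T) ≡ #u (X ++ T')
#u-tail-≡ X {T} {T'} e = trans (#u-++ X T) (trans (cong (#u X +_) e) (sym (#u-++ X T')))

height-delete-d : ∀ X T → height (X ++ T) ≡ 1ℤ +ℤ height (X ++ d ∷ T)
height-delete-d X T = begin
  height (X ++ T)                                ≡⟨ height-++ X T ⟩
  height X +ℤ height T                           ≡⟨ shift (height X) (height T) ⟩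
  1ℤ +ℤ (height X +ℤ height (d ∷ T))             ≡⟨ cong (1ℤ +ℤ_) (height-++ X (d ∷ T)) ⟨
  1ℤ +ℤ height (X ++ d ∷ T)                      ∎
  where
  open ≡-Reasoning
  shift : ∀ x y → x +ℤ y ≡ 1ℤ +ℤ (x +ℤ (- 1ℤ +ℤ y))
  shift = solve-∀

#u-delete-d : ∀ X T → #u (X ++ d ∷ T) ≡ #u (X ++ T)
#u-delete-d []      T = refl
#u-delete-d (u ∷ X) T = cong suc (#u-delete-d X T)
#u-delete-d (d ∷ X) T = #u-delete-d X T

height-move-d : ∀ W T → height (d ∷ W ++ T) ≡ height (W ++ d ∷ T)
height-move-d W T = begin
  - 1ℤ +ℤ height (W ++ T)            ≡⟨ cong (- 1ℤ +ℤ_) (height-++ W T) ⟩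
  - 1ℤ +ℤ (height W +ℤ height T)     ≡⟨ swap (height W) (height T) ⟩
  height W +ℤ (- 1ℤ +ℤ height T)     ≡⟨ height-++ W (d ∷ T) ⟨
  height (W ++ d ∷ T)                ∎
  where
  open ≡-Reasoning
  swap : ∀ x y → - 1ℤ +ℤ (x +ℤ y) ≡ x +ℤ (- 1ℤ +ℤ y)
  swap = solve-∀

record Arch (w : Word) (p m : ℕ) : Set where
  field
    opens   : at w p ≡ just u
    ordered : p < m
    closes  : at w m ≡ just d
    returns : heightAt w (suc m) ≡ heightAt w p
    above   : ∀ k → p < k → k ≤ m → heightAt w p ℤ.< heightAt w k

heightAt-suc : ∀ w k {s} → at w k ≡ just s → heightAt w (suc k) ≡ val s +ℤ heightAt w k
heightAt-suc w k {s} e = begin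
  height (take (suc k) w)              ≡⟨ cong height (take-suc w k e) ⟩
  height (take k w ++ s ∷ [])          ≡⟨ height-++ (take k w) (s ∷ []) ⟩
  heightAt w k +ℤ height (s ∷ [])      ≡⟨ cong (heightAt w k +ℤ_) (single s) ⟩
  heightAt w k +ℤ val s                ≡⟨ ℤP.+-comm (heightAt w k) (val s) ⟩
  val s +ℤ heightAt w k                ∎
  where
  open ≡-Reasoning
  single : ∀ s → height (s ∷ []) ≡ val s
  single u = refl
  single d = refl

-- A matching pair is an arch: before the first return to the starting
-- height the path stays strictly above it.
matches⇒arch : ∀ w {p m} → Matches w p m → Arch w p m
matches⇒arch w {p} {m} (up , p<m , (down , ret) , first) = record
  { opens = letterAt⇒at w p up ; ordered = p<m ; closes = letterAt⇒at w m down
  ; returns = ret ; above = above }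
  where
  h₀ : ℤ
  h₀ = heightAt w p

  above : ∀ k → p < k → k ≤ m → h₀ ℤ.< heightAt w k
  above (suc k) (s≤s p≤k) k<m with p ℕ.≟ k
  ... | yes refl = subst (h₀ ℤ.<_) (sym (heightAt-suc w p (letterAt⇒at w p up)))
                         (ℤP.suc[i]≤j⇒i<j ℤP.≤-refl)
  ... | no p≢k with occupied-before w k<m (letterAt⇒at w m down)
  ...   | u , at-k = subst (h₀ ℤ.<_) (sym (heightAt-suc w k at-k))
                           (ℤP.<-trans below (ℤP.suc[i]≤j⇒i<j ℤP.≤-refl))
    where below = above k (ℕP.≤∧≢⇒< p≤k p≢k) (ℕP.<⇒≤ k<m)
  ...   | d , at-k = ℤP.≤∧≢⇒< weakly (λ e → first k p<k k<m (at⇒letterAt w k at-k , sym e))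
    where
    p<k = ℕP.≤∧≢⇒< p≤k p≢k
    weakly : h₀ ℤ.≤ heightAt w (suc k)
    weakly = subst (h₀ ℤ.≤_) (sym (heightAt-suc w k at-k))
                   (ℤP.i<j⇒i≤pred[j] (above k p<k (ℕP.<⇒≤ k<m)))

arch⇒matches : ∀ w {p m} → Arch w p m → Matches w p m
arch⇒matches w {p} {m} arch =
  at⇒letterAt w p opens , ordered , (at⇒letterAt w m closes , returns) ,
  λ k p<k k<m down → ℤP.<-irrefl (sym (proj₂ down)) (above (suc k) (ℕP.m≤n⇒m≤1+n p<k) k<m)
  where open Arch arch

factor : ∀ {w i j p m q} → UpPos w j p → Arch w p m → UpPos w i q → p < q → q < m →
         UpInFactor w i j
factor {w} {p = p} {m} {q} j-at-p arch i-at-q p<q q<m =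
  p , m , q , j-at-p , arch⇒matches w arch , i-at-q , p<q , q<m

upPos-transfer : ∀ {w w' i x y} → at w x ≡ at w' y → upsBefore w x ≡ upsBefore w' y →
                 UpPos w i x → UpPos w' i y
upPos-transfer {w} {w'} {x = x} {y} same-letter same-ups (up , index) =
  at⇒letterAt w' y (trans (sym same-letter) (letterAt⇒at w x up)) ,
  trans (cong suc (sym same-ups)) index

arch-transfer : ∀ {w w' p m} → at w p ≡ at w' p → at w m ≡ at w' m →
                (∀ k → p ≤ k → k ≤ suc m → heightAt w k ≡ heightAt w' k) →
                Arch w p m → Arch w' p m
arch-transfer {p = p} {m} same-p same-m same-heights arch = record
  { opens   = trans (sym same-p) opens
  ; ordered = ordered
  ; closes  = trans (sym same-m) closes
  ; returns = trans (sym (same-heights (suc m) p≤1+m ℕP.≤-refl))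
                    (trans returns (same-heights p ℕP.≤-refl p≤1+m))
  ; above   = λ k p<k k≤m →
      subst₂ ℤ._<_ (same-heights p ℕP.≤-refl p≤1+m)
                   (same-heights k (ℕP.<⇒≤ p<k) (ℕP.m≤n⇒m≤1+n k≤m)) (above k p<k k≤m)
  }
  where
  open Arch arch
  p≤1+m : p ≤ suc m
  p≤1+m = ℕP.m≤n⇒m≤1+n (ℕP.<⇒≤ ordered)

module Covering (A U C : Word) (U-dyck : IsDyck U) where

  P Q : Word
  P = A ++ d ∷ U ++ C
  Q = A ++ U ++ d ∷ C

  a ℓ : ℕ
  a = length A
  ℓ = length U

  unshift-< : ∀ {x y} → a + suc x < a + suc y → x < y
  unshift-< {x} {y} lt = ℕ.s<s⁻¹ (ℕP.+-cancelˡ-< a (suc x) (suc y) lt)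

  inside-U : ∀ {x} → a < x → x < a + suc ℓ → ∃[ r ] r < ℓ × x ≡ a + suc r
  inside-U a<x x<end with ℕP.m≤n⇒∃[o]m+o≡n a<x
  ... | r , refl = r , unshift-< (subst (_< a + suc ℓ) (sym (ℕP.+-suc a r)) x<end)
                     , sym (ℕP.+-suc a r)

  data Region (x : ℕ) : Set where
    inA : x < a → Region x
    atD : x ≡ a → Region x
    inU : ∀ r → r < ℓ → x ≡ a + suc r → Region x
    inC : a + suc ℓ ≤ x → Region x

  region : ∀ x → Region x
  region x with ℕP.<-cmp x a
  ... | tri< x<a _ _ = inA x<a
  ... | tri≈ _ x≡a _ = atD x≡a
  ... | tri> _ _ a<x with x ℕP.<? a + suc ℓ
  ...   | no  x≮end = inC (ℕP.≮⇒≥ x≮end)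
  ...   | yes x<end with inside-U a<x x<end
  ...     | r , r<ℓ , x≡ = inU r r<ℓ x≡

  C-offset : ∀ r → a + suc ℓ + r ≡ a + (ℓ + suc r)
  C-offset r = trans (ℕP.+-assoc a (suc ℓ) r) (cong (a +_) (sym (ℕP.+-suc ℓ r)))

  take-A : ∀ k → k ≤ a → take k P ≡ take k Q
  take-A k k≤a = trans (take-++ˡ A _ k k≤a) (sym (take-++ˡ A _ k k≤a))

  take-P-U : ∀ r → r ≤ ℓ → take (a + suc r) P ≡ A ++ d ∷ take r U
  take-P-U r r≤ℓ =
    trans (take-++ʳ A (d ∷ U ++ C) (suc r)) (cong (λ T → A ++ d ∷ T) (take-++ˡ U C r r≤ℓ))

  take-Q-U : ∀ r → r ≤ ℓ → take (a + r) Q ≡ A ++ take r U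
  take-Q-U r r≤ℓ =
    trans (take-++ʳ A (U ++ d ∷ C) r) (cong (A ++_) (take-++ˡ U (d ∷ C) r r≤ℓ))

  take-P-C : ∀ r → take (a + suc ℓ + r) P ≡ A ++ d ∷ U ++ take r C
  take-P-C r = begin
    take (a + suc ℓ + r) P           ≡⟨ cong (λ n → take n P) (ℕP.+-assoc a (suc ℓ) r) ⟩
    take (a + (suc ℓ + r)) P         ≡⟨ take-++ʳ A (d ∷ U ++ C) (suc ℓ + r) ⟩
    A ++ d ∷ take (ℓ + r) (U ++ C)   ≡⟨ cong (λ T → A ++ d ∷ T) (take-++ʳ U C r) ⟩
    A ++ d ∷ U ++ take r C           ∎
    where open ≡-Reasoning

  take-Q-C : ∀ r → take (a + suc ℓ + r) Q ≡ A ++ U ++ d ∷ take r C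
  take-Q-C r = begin
    take (a + suc ℓ + r) Q               ≡⟨ cong (λ n → take n Q) (C-offset r) ⟩
    take (a + (ℓ + suc r)) Q             ≡⟨ take-++ʳ A (U ++ d ∷ C) (ℓ + suc r) ⟩
    A ++ take (ℓ + suc r) (U ++ d ∷ C)   ≡⟨ cong (A ++_) (take-++ʳ U (d ∷ C) (suc r)) ⟩
    A ++ U ++ d ∷ take r C               ∎
    where open ≡-Reasoning

  d-at-P : at P a ≡ just d
  d-at-P = cong head (drop-++-length A (d ∷ U ++ C))

  d-at-Q : at Q (a + ℓ) ≡ just d
  d-at-Q = cong head (trans (drop-++ʳ A (U ++ d ∷ C) ℓ) (drop-++-length U (d ∷ C)))

  A-letters : ∀ k → k < a → at P k ≡ at Q k
  A-letters k k<a = trans (head-drop-++ˡ A _ k k<a) (sym (head-drop-++ˡ A _ k k<a))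

  A-heights : ∀ k → k ≤ a → heightAt P k ≡ heightAt Q k
  A-heights k k≤a = cong height (take-A k k≤a)

  A-ups : ∀ k → k ≤ a → upsBefore P k ≡ upsBefore Q k
  A-ups k k≤a = cong #u (take-A k k≤a)

  C-letters : ∀ k → a + suc ℓ ≤ k → at P k ≡ at Q k
  C-letters k C≤k with ℕP.m≤n⇒∃[o]m+o≡n C≤k
  ... | r , refl = cong head (trans
        (trans (cong (λ n → drop n P) (ℕP.+-assoc a (suc ℓ) r))
               (trans (drop-++ʳ A (d ∷ U ++ C) (suc ℓ + r)) (drop-++ʳ U C r)))
        (sym (trans (cong (λ n → drop n Q) (C-offset r))
               (trans (drop-++ʳ A (U ++ d ∷ C) (ℓ + suc r)) (drop-++ʳ U (d ∷ C) (suc r))))))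

  C-heights : ∀ k → a + suc ℓ ≤ k → heightAt P k ≡ heightAt Q k
  C-heights k C≤k with ℕP.m≤n⇒∃[o]m+o≡n C≤k
  ... | r , refl = begin
    heightAt P (a + suc ℓ + r)        ≡⟨ cong height (take-P-C r) ⟩
    height (A ++ d ∷ U ++ take r C)   ≡⟨ height-tail-≡ A (height-move-d U (take r C)) ⟩
    height (A ++ U ++ d ∷ take r C)   ≡⟨ cong height (take-Q-C r) ⟨
    heightAt Q (a + suc ℓ + r)        ∎
    where open ≡-Reasoning

  C-ups : ∀ k → a + suc ℓ ≤ k → upsBefore P k ≡ upsBefore Q k
  C-ups k C≤k with ℕP.m≤n⇒∃[o]m+o≡n C≤k
  ... | r , refl = begin
    upsBefore P (a + suc ℓ + r)     ≡⟨ cong #u (take-P-C r) ⟩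
    #u (A ++ d ∷ U ++ take r C)     ≡⟨ #u-tail-≡ A (sym (#u-delete-d U (take r C))) ⟩
    #u (A ++ U ++ d ∷ take r C)     ≡⟨ cong #u (take-Q-C r) ⟨
    upsBefore Q (a + suc ℓ + r)     ∎
    where open ≡-Reasoning

  U-letters : ∀ r → r < ℓ → at P (a + suc r) ≡ at Q (a + r)
  U-letters r r<ℓ = trans
    (trans (cong head (drop-++ʳ A (d ∷ U ++ C) (suc r))) (head-drop-++ˡ U C r r<ℓ))
    (sym (trans (cong head (drop-++ʳ A (U ++ d ∷ C) r)) (head-drop-++ˡ U (d ∷ C) r r<ℓ)))

  U-heights : ∀ r → r ≤ ℓ → heightAt Q (a + r) ≡ 1ℤ +ℤ heightAt P (a + suc r)
  U-heights r r≤ℓ = begin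
    heightAt Q (a + r)                ≡⟨ cong height (take-Q-U r r≤ℓ) ⟩
    height (A ++ take r U)            ≡⟨ height-delete-d A (take r U) ⟩
    1ℤ +ℤ height (A ++ d ∷ take r U)  ≡⟨ cong (λ T → 1ℤ +ℤ height T) (take-P-U r r≤ℓ) ⟨
    1ℤ +ℤ heightAt P (a + suc r)      ∎
    where open ≡-Reasoning

  U-ups : ∀ r → r ≤ ℓ → upsBefore P (a + suc r) ≡ upsBefore Q (a + r)
  U-ups r r≤ℓ = trans (cong #u (take-P-U r r≤ℓ))
    (trans (#u-delete-d A (take r U)) (cong #u (sym (take-Q-U r r≤ℓ))))

  -- As U is a Dyck word, inside U neither path goes below the height where
  -- U starts, and P is back at that height when U ends.
  U-nonneg : ∀ r → 0ℤ ℤ.≤ heightAt U r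
  U-nonneg r = proj₁ U-dyck (take r U) (drop r U) (sym (LP.take++drop≡id r U))

  P-floor : ∀ r → r ≤ ℓ → heightAt P (a + 1) ℤ.≤ heightAt P (a + suc r)
  P-floor r r≤ℓ = subst₂ ℤ._≤_ (cong height (sym (take-P-U 0 z≤n)))
    (cong height (sym (take-P-U r r≤ℓ))) (height-tail-≤ A (ℤP.+-monoʳ-≤ (- 1ℤ) (U-nonneg r)))

  Q-floor : ∀ r → r ≤ ℓ → heightAt Q a ℤ.≤ heightAt Q (a + r)
  Q-floor r r≤ℓ = subst₂ ℤ._≤_
    (trans (cong height (sym (take-Q-U 0 z≤n))) (cong (heightAt Q) (ℕP.+-identityʳ a)))
    (cong height (sym (take-Q-U r r≤ℓ))) (height-tail-≤ A (U-nonneg r))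

  P-back-to-floor : heightAt P (a + suc ℓ) ≡ heightAt P (a + 1)
  P-back-to-floor = begin
    heightAt P (a + suc ℓ)          ≡⟨ cong height (take-P-U ℓ ℕP.≤-refl) ⟩
    height (A ++ d ∷ take ℓ U)      ≡⟨ height-tail-≡ A (cong (- 1ℤ +ℤ_) U-returns) ⟩
    height (A ++ d ∷ take 0 U)      ≡⟨ cong height (take-P-U 0 z≤n) ⟨
    heightAt P (a + 1)              ∎
    where
    open ≡-Reasoning
    U-returns : heightAt U ℓ ≡ 0ℤ
    U-returns = trans (cong height (LP.take-all ℓ U ℕP.≤-refl)) (proj₂ U-dyck)

  up-A : ∀ {i x} → x < a → UpPos P i x → UpPos Q i x
  up-A {x = x} x<a = upPos-transfer {P} {Q} {x = x} {x} (A-letters x x<a) (A-ups x (ℕP.<⇒≤ x<a))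

  up-U : ∀ {i r} → r < ℓ → UpPos P i (a + suc r) → UpPos Q i (a + r)
  up-U {r = r} r<ℓ = upPos-transfer {P} {Q} {x = a + suc r} {a + r} (U-letters r r<ℓ) (U-ups r (ℕP.<⇒≤ r<ℓ))

  up-C : ∀ {i x} → a + suc ℓ ≤ x → UpPos P i x → UpPos Q i x
  up-C {x = x} C≤x = upPos-transfer {P} {Q} {x = x} {x} (C-letters x C≤x) (C-ups x C≤x)

  not-up-at-d : ∀ {i} → ¬ UpPos P i a
  not-up-at-d (up , _) with trans (sym (letterAt⇒at P a up)) d-at-P
  ... | ()

  arch-A : ∀ {p m} → m < a → Arch P p m → Arch Q p m
  arch-A {p} {m} m<a arch = arch-transfer (A-letters p (ℕP.<-trans ordered m<a))
    (A-letters m m<a) (λ k _ k≤1+m → A-heights k (ℕP.≤-trans k≤1+m m<a)) arch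
    where open Arch arch

  arch-C : ∀ {p m} → a + suc ℓ ≤ p → Arch P p m → Arch Q p m
  arch-C {p} {m} C≤p arch = arch-transfer (C-letters p C≤p)
    (C-letters m (ℕP.≤-trans C≤p (ℕP.<⇒≤ ordered)))
    (λ k p≤k _ → C-heights k (ℕP.≤-trans C≤p p≤k)) arch
    where open Arch arch

  arch-U : ∀ {rp rm} → rm < ℓ → Arch P (a + suc rp) (a + suc rm) → Arch Q (a + rp) (a + rm)
  arch-U {rp} {rm} rm<ℓ arch = record
    { opens   = trans (sym (U-letters rp rp<ℓ)) opens
    ; ordered = ℕP.+-monoʳ-< a rp<rm
    ; closes  = trans (sym (U-letters rm rm<ℓ)) closes
    ; returns = begin
        heightAt Q (suc (a + rm))             ≡⟨ cong (heightAt Q) (ℕP.+-suc a rm) ⟨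
        heightAt Q (a + suc rm)               ≡⟨ U-heights (suc rm) rm<ℓ ⟩
        1ℤ +ℤ heightAt P (a + suc (suc rm))   ≡⟨ cong (λ k → 1ℤ +ℤ heightAt P k) (ℕP.+-suc a (suc rm)) ⟩
        1ℤ +ℤ heightAt P (suc (a + suc rm))   ≡⟨ cong (1ℤ +ℤ_) returns ⟩
        1ℤ +ℤ heightAt P (a + suc rp)         ≡⟨ U-heights rp (ℕP.<⇒≤ rp<ℓ) ⟨
        heightAt Q (a + rp)                   ∎
    ; above   = above-Q
    }
    where
    open Arch arch
    open ≡-Reasoning
    rp<rm : rp < rm
    rp<rm = unshift-< ordered
    rp<ℓ : rp < ℓ
    rp<ℓ = ℕP.<-trans rp<rm rm<ℓ
    above-Q : ∀ k → a + rp < k → k ≤ a + rm → heightAt Q (a + rp) ℤ.< heightAt Q k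
    above-Q k p<k k≤m with ℕP.m≤n⇒∃[o]m+o≡n (ℕP.≤-trans (ℕP.m≤m+n a rp) (ℕP.<⇒≤ p<k))
    ... | r , refl = subst₂ ℤ._<_ (sym (U-heights rp (ℕP.<⇒≤ rp<ℓ))) (sym (U-heights r r≤ℓ))
          (ℤP.+-monoʳ-< 1ℤ (above (a + suc r) (ℕP.+-monoʳ-< a (s≤s rp<r)) (ℕP.+-monoʳ-≤ a (s≤s r≤rm))))
      where
      rp<r = ℕP.+-cancelˡ-< a rp r p<k
      r≤rm = ℕP.+-cancelˡ-≤ a r rm k≤m
      r≤ℓ  = ℕP.≤-trans r≤rm (ℕP.<⇒≤ rm<ℓ)

  -- An arch of P from A that reaches the moved d ends above the height at the
  -- end of A, so in Q it stays above it all along U.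
  above-U : ∀ {p m} → p < a → a ≤ m → Arch P p m →
            ∀ k → a < k → k ≤ a + ℓ → heightAt Q p ℤ.< heightAt Q k
  above-U {p} p<a a≤m arch k a<k k≤end with ℕP.m≤n⇒∃[o]m+o≡n (ℕP.<⇒≤ a<k)
  ... | r , refl = begin-strict
    heightAt Q p         ≡⟨ A-heights p (ℕP.<⇒≤ p<a) ⟨
    heightAt P p         <⟨ above a p<a a≤m ⟩
    heightAt P a         ≡⟨ A-heights a ℕP.≤-refl ⟩
    heightAt Q a         ≤⟨ Q-floor r (ℕP.+-cancelˡ-≤ a r ℓ k≤end) ⟩
    heightAt Q (a + r)   ∎
    where
    open Arch arch
    open ℤP.≤-Reasoning

  above-from-A : ∀ {p m} m' → p < a → a ≤ m → Arch P p m →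
                 (∀ k → a + suc ℓ ≤ k → k ≤ m' → k ≤ m) →
                 ∀ k → p < k → k ≤ m' → heightAt Q p ℤ.< heightAt Q k
  above-from-A {p} m' p<a a≤m arch in-arch k p<k k≤m' with k ℕP.≤? a | a + suc ℓ ℕP.≤? k
  ... | yes k≤a | _       = subst₂ ℤ._<_ (A-heights p (ℕP.<⇒≤ p<a)) (A-heights k k≤a)
                                 (above k p<k (ℕP.≤-trans k≤a a≤m))
    where open Arch arch
  ... | no k≰a  | yes C≤k = subst₂ ℤ._<_ (A-heights p (ℕP.<⇒≤ p<a)) (C-heights k C≤k)
                                 (above k p<k (in-arch k C≤k k≤m'))
    where open Arch arch
  ... | no k≰a  | no k≱C  = above-U p<a a≤m arch k (ℕP.≰⇒> k≰a)
                              (ℕ.s≤s⁻¹ (subst (k <_) (ℕP.+-suc a ℓ) (ℕP.≰⇒> k≱C)))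

  arch-A-to-d : ∀ {p} → Arch P p a → Arch Q p (a + ℓ)
  arch-A-to-d {p} arch = record
    { opens   = trans (sym (A-letters p ordered)) opens
    ; ordered = ℕP.<-≤-trans ordered (ℕP.m≤m+n a ℓ)
    ; closes  = d-at-Q
    ; returns = begin
        heightAt Q (suc (a + ℓ))  ≡⟨ cong (heightAt Q) (ℕP.+-suc a ℓ) ⟨
        heightAt Q (a + suc ℓ)    ≡⟨ C-heights (a + suc ℓ) ℕP.≤-refl ⟨
        heightAt P (a + suc ℓ)    ≡⟨ P-back-to-floor ⟩
        heightAt P (a + 1)        ≡⟨ cong (heightAt P) (ℕP.+-comm a 1) ⟩
        heightAt P (suc a)        ≡⟨ returns ⟩
        heightAt P p              ≡⟨ A-heights p (ℕP.<⇒≤ ordered) ⟩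
        heightAt Q p              ∎
    ; above   = above-from-A (a + ℓ) ordered ℕP.≤-refl arch
                  (λ k C≤k k≤end → ⊥-elim (ℕP.<-irrefl refl
                     (ℕP.<-≤-trans (ℕP.+-monoʳ-< a (ℕP.n<1+n ℓ)) (ℕP.≤-trans C≤k k≤end))))
    }
    where
    open Arch arch
    open ≡-Reasoning

  arch-A-to-C : ∀ {p m} → p < a → a + suc ℓ ≤ m → Arch P p m → Arch Q p m
  arch-A-to-C {p} {m} p<a C≤m arch = record
    { opens   = trans (sym (A-letters p p<a)) opens
    ; ordered = ordered
    ; closes  = trans (sym (C-letters m C≤m)) closes
    ; returns = trans (sym (C-heights (suc m) (ℕP.m≤n⇒m≤1+n C≤m)))
                      (trans returns (A-heights p (ℕP.<⇒≤ p<a)))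
    ; above   = above-from-A m p<a a≤m arch (λ _ _ k≤m → k≤m)
    }
    where
    open Arch arch
    a≤m : a ≤ m
    a≤m = ℕP.≤-trans (ℕP.m≤m+n a (suc ℓ)) C≤m

  -- An arch of P from A cannot end inside U: right after the moved d the
  -- path is already below the arch's start, and U never goes lower.
  no-arch-A-to-U : ∀ {p rm} → p < a → rm < ℓ → ¬ Arch P p (a + suc rm)
  no-arch-A-to-U {p} {rm} p<a rm<ℓ arch = ℤP.<-irrefl refl (begin-strict
    heightAt P p                    <⟨ above (a + 1) (ℕP.<-≤-trans p<a (ℕP.m≤m+n a 1))
                                              (ℕP.+-monoʳ-≤ a (s≤s z≤n)) ⟩
    heightAt P (a + 1)              ≤⟨ P-floor (suc rm) rm<ℓ ⟩
    heightAt P (a + suc (suc rm))   ≡⟨ cong (heightAt P) (ℕP.+-suc a (suc rm)) ⟩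
    heightAt P (suc (a + suc rm))   ≡⟨ returns ⟩
    heightAt P p                    ∎)
    where
    open Arch arch
    open ℤP.≤-Reasoning

  -- An arch of P from U cannot reach C: at the end of U the path is back at
  -- the lowest height of U, which is not above the arch's start.
  no-arch-U-to-C : ∀ {rp m} → rp < ℓ → a + suc ℓ ≤ m → ¬ Arch P (a + suc rp) m
  no-arch-U-to-C {rp} rp<ℓ C≤m arch = ℤP.<-irrefl refl (begin-strict
    heightAt P (a + suc rp)   <⟨ above (a + suc ℓ) (ℕP.+-monoʳ-< a (s≤s rp<ℓ)) C≤m ⟩
    heightAt P (a + suc ℓ)    ≡⟨ P-back-to-floor ⟩
    heightAt P (a + 1)        ≤⟨ P-floor rp (ℕP.<⇒≤ rp<ℓ) ⟩
    heightAt P (a + suc rp)   ∎)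
    where
    open Arch arch
    open ℤP.≤-Reasoning

  up-inside : ∀ {i p m q} → p < a → a + suc ℓ ≤ m → p < q → q < m → UpPos P i q →
              ∃[ q' ] UpPos Q i q' × p < q' × q' < m
  up-inside {q = q} p<a C≤m p<q q<m i-at-q with region q
  ... | inA q<a          = q , up-A q<a i-at-q , p<q , q<m
  ... | atD refl         = ⊥-elim (not-up-at-d i-at-q)
  ... | inU rq rq<ℓ refl = a + rq , up-U rq<ℓ i-at-q , ℕP.<-≤-trans p<a (ℕP.m≤m+n a rq) ,
                           ℕP.<-≤-trans (ℕP.+-monoʳ-< a (ℕP.m<n⇒m<1+n rq<ℓ)) C≤m
  ... | inC C≤q          = q , up-C C≤q i-at-q , p<q , q<m

  from-A : ∀ {i j p m q} → p < a → UpPos P j p → Arch P p m → UpPos P i q → p < q → q < m →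
           UpInFactor Q i j
  from-A {m = m} p<a j-at-p arch i-at-q p<q q<m with region m
  ... | inA m<a          = factor (up-A p<a j-at-p) (arch-A m<a arch)
                                  (up-A (ℕP.<-trans q<m m<a) i-at-q) p<q q<m
  ... | atD refl         = factor (up-A p<a j-at-p) (arch-A-to-d arch) (up-A q<m i-at-q) p<q
                                  (ℕP.<-≤-trans q<m (ℕP.m≤m+n a ℓ))
  ... | inU rm rm<ℓ refl = ⊥-elim (no-arch-A-to-U p<a rm<ℓ arch)
  ... | inC C≤m with up-inside p<a C≤m p<q q<m i-at-q
  ...   | q' , i-at-q' , p<q' , q'<m =
          factor (up-A p<a j-at-p) (arch-A-to-C p<a C≤m arch) i-at-q' p<q' q'<m

  from-U : ∀ {i j rp m q} → rp < ℓ → UpPos P j (a + suc rp) → Arch P (a + suc rp) m →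
           UpPos P i q → a + suc rp < q → q < m → UpInFactor Q i j
  from-U {rp = rp} {m} rp<ℓ j-at-p arch i-at-q p<q q<m with a + suc ℓ ℕP.≤? m
  ... | yes C≤m = ⊥-elim (no-arch-U-to-C rp<ℓ C≤m arch)
  ... | no  m≱C with inside-U a<m m<C | inside-U (ℕP.<-trans a<p p<q) (ℕP.<-trans q<m m<C)
    where
    a<p : a < a + suc rp
    a<p = ℕP.m<m+n a (s≤s z≤n)
    a<m = ℕP.<-trans a<p (Arch.ordered arch)
    m<C = ℕP.≰⇒> m≱C
  ... | rm , rm<ℓ , refl | rq , rq<ℓ , refl =
    factor (up-U rp<ℓ j-at-p) (arch-U rm<ℓ arch) (up-U rq<ℓ i-at-q)
           (ℕP.+-monoʳ-< a (unshift-< p<q)) (ℕP.+-monoʳ-< a (unshift-< q<m))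

  from-C : ∀ {i j p m q} → a + suc ℓ ≤ p → UpPos P j p → Arch P p m → UpPos P i q →
           p < q → q < m → UpInFactor Q i j
  from-C C≤p j-at-p arch i-at-q p<q q<m =
    factor (up-C C≤p j-at-p) (arch-C C≤p arch) (up-C (ℕP.≤-trans C≤p (ℕP.<⇒≤ p<q)) i-at-q) p<q q<m

  step : ∀ {i j} → UpInFactor P i j → UpInFactor Q i j
  step (p , m , q , j-at-p , match , i-at-q , p<q , q<m) with region p
  ... | inA p<a          = from-A p<a j-at-p (matches⇒arch P match) i-at-q p<q q<m
  ... | atD refl         = ⊥-elim (not-up-at-d j-at-p)
  ... | inU rp rp<ℓ refl = from-U rp<ℓ j-at-p (matches⇒arch P match) i-at-q p<q q<m
  ... | inC C≤p          = from-C C≤p j-at-p (matches⇒arch P match) i-at-q p<q q<m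

cover-preserves : ∀ {P Q} i j → Covers P Q → UpInFactor P i j → UpInFactor Q i j
cover-preserves i j (cover A U C (U-dyck , _) refl refl) = Covering.step A U C U-dyck

tamari-preserves : ∀ {P Q} i j → P ≤T Q → UpInFactor P i j → UpInFactor Q i j
tamari-preserves i j ε        = id
tamari-preserves i j (c ◅ cs) = tamari-preserves i j cs ∘ cover-preserves i j c

-- The size and index-range hypotheses are not needed.
lemma2 : (n : ℕ) (P Q : Word) → DyckOfSize n P → DyckOfSize n Q → P ≤T Q →
         (i j : ℕ) → 1 ≤ i → i ≤ n → 1 ≤ j → j ≤ n →
         UpInFactor P i j → UpInFactor Q i j
lemma2 n P Q _ _ P≤Q i j _ _ _ _ = tamari-preserves i j P≤Q
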